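{- Let $G$ be a non-complete graph with chromatic number $\chi(G)=k$, and let $V_1,V_2,\dots,V_k$ be the colour classes of a proper $k$-colouring of $G$ with $|V_1|\le|V_2|\le\cdots\le|V_k|$. (1) If there is an $\ell\ge1$ such that $|V_i|=1$ for $1\le i\le\ell$ and $|V_i|>1$ for $\ell<i\le k$, then $\tau_s(G)\le \ell-1+\sum_{i=\ell+1}^{k}\lceil\log_2|V_i|\rceil$. (2) If $|V_1|\ge2$, then $\tau_s(G)\le\sum_{i=1}^{k}\lceil\log_2|V_i|\rceil$.
   Context: For vertices $u,v,w$ of a connected graph, $w$ strongly resolves $u,v$ if there is a shortest $u$-$w$ path containing $v$ or a shortest $v$-$w$ path containing $u$. A strong resolving set is a set $W$ such that every pair of vertices is strongly resolved by some vertex of $W$; the strong dimension $\beta_s(H)$ is the minimum size of a strong resolving set of $H$. The threshold strong dimension $\tau_s(G)$ is the minimum of $\beta_s(H)$ over all (connected) graphs $H$ having $G$ as a spanning subgraph. -}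

module Defs where

open import Level using (0ℓ)
open import Data.Nat using (ℕ; zero; suc; _≤_; _<_; _≤?_)
open import Data.Fin using (Fin; toℕ)
open import Data.Fin.Properties using (_≟_)
open import Data.List using (List; length; filter; map; allFin)
open import Data.Nat.ListAction using (sum)
open import Data.Product using (Σ; ∃; _×_; _,_)
open import Data.Sum using (_⊎_)
open import Relation.Nullary using (¬_)
open import Relation.Binary.PropositionalEquality using (_≡_; _≢_)

record Graph (n : ℕ) : Set₁ where
  field
    Adj    : Fin n → Fin n → Set
    sym    : ∀ {u v} → Adj u v → Adj v u
    irrefl : ∀ {u} → ¬ Adj u u
open Graph public

module _ {n : ℕ} (G : Graph n) where

  data Walk : Fin n → Fin n → ℕ → Set where
    nil  : ∀ {u} → Walk u u 0
    cons : ∀ {u x v k} → Adj G u x → Walk x v k → Walk u v (suc k)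

  data OnWalk (x : Fin n) : ∀ {u v k} → Walk u v k → Set where
    here  : ∀ {v k} {p : Walk x v k} → OnWalk x p
    there : ∀ {u y v k} {e : Adj G u y} {p : Walk y v k} → OnWalk x p → OnWalk x (cons e p)

  Shortest : ∀ {u v k} → Walk u v k → Set
  Shortest {u} {v} {k} _ = ∀ {j} → Walk u v j → k ≤ j

  Connected : Set
  Connected = ∀ u v → ∃ λ k → Walk u v k

  StronglyResolves : Fin n → Fin n → Fin n → Set
  StronglyResolves w u v =
      (∃ λ k → Σ (Walk u w k) λ p → Shortest p × OnWalk v p)
    ⊎ (∃ λ k → Σ (Walk v w k) λ p → Shortest p × OnWalk u p)

  StrongResolvingSet : List (Fin n) → Set
  StrongResolvingSet W = ∀ u v → u ≢ v → ∃ λ w → w ∈ W × StronglyResolves w u v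
    where open import Data.List.Membership.Propositional using (_∈_)

  IsStrongDim : ℕ → Set
  IsStrongDim b =
      (Σ (List (Fin n)) λ W → Unique W × StrongResolvingSet W × length W ≡ b)
    × (∀ W → Unique W → StrongResolvingSet W → b ≤ length W)
    where open import Data.List.Relation.Unary.Unique.Propositional using (Unique)

  NonComplete : Set
  NonComplete = ∃ λ u → ∃ λ v → u ≢ v × ¬ Adj G u v

  ProperColouring : (k : ℕ) → (Fin n → Fin k) → Set
  ProperColouring k c = ∀ {u v} → Adj G u v → c u ≢ c v

  IsChromaticNumber : ℕ → Set
  IsChromaticNumber k =
      (Σ (Fin n → Fin k) λ c → ProperColouring k c)
    × (∀ j (c : Fin n → Fin j) → ProperColouring j c → k ≤ j)

SpanningSubgraph : ∀ {n} → Graph n → Graph n → Set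
SpanningSubgraph G H = ∀ {u v} → Adj G u v → Adj H u v

IsThresholdStrongDim : ∀ {n} → Graph n → ℕ → Set₁
IsThresholdStrongDim {n} G t =
    (Σ (Graph n) λ H → SpanningSubgraph G H × Connected H × IsStrongDim H t)
  × (∀ (H : Graph n) b → SpanningSubgraph G H → Connected H → IsStrongDim H b → t ≤ b)

classSize : ∀ {n k} → (Fin n → Fin k) → Fin k → ℕ
classSize {n} c i = length (filter (λ v → c v ≟ i) (allFin n))

-- Σ_{i = a+1}^{k} f(i), colours indexed 0..k-1 (so paper's index i is toℕ i + 1)
sumFrom : ∀ {k} → ℕ → (Fin k → ℕ) → ℕ
sumFrom {k} a f = sum (map f (filter (λ i → a ≤? toℕ i) (allFin k)))

module Submission where

-- Add edges to G to obtain a supergraph H of diameter two whose strong dimension is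
-- small. Colour class i receives a budget of a_i "landmarks" (its first a_i vertices), and
-- one further vertex z of a chosen hub class is joined to every vertex. The remaining
-- ("coded") vertices of class i are numbered by distinct codes in [0, 2^{a_i} − 1), and
-- the landmark of rank j is joined to a coded vertex of its class exactly when bit j of its
-- code is 1. All other pairs (different classes, two non-landmarks) are joined. In H every
-- pair of distinct non-landmarks is adjacent and is separated by some landmark, which
-- makes the landmarks a strong resolving set; hence τ_s(G) ≤ Σ_i a_i (`Design.budget-bound`).
-- Parts (1) and (2) follow by choosing a_i = ⌈log₂ |V_i|⌉ for the large classes, and for
-- part (1) a_i = 1 for all singleton classes but the last, which serves as the hub.

open import Defs hiding (sym)
open import Axiom.UniquenessOfIdentityProofs using (module Decidable⇒UIP)
open import Data.Bool using (Bool; true; false; not; if_then_else_)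
import Data.Bool.Properties as Bool
open import Data.Fin using (Fin; toℕ; fromℕ<) renaming (zero to fzero; suc to fsuc)
open import Data.Fin.Properties using (_≟_; toℕ<n; toℕ-fromℕ<; toℕ-injective)
open import Data.List using (List; []; _∷_; length; map; filter; allFin; tabulate; take; lookup; concatMap; deduplicate)
open import Data.List.Properties using (map-tabulate; length-++; length-take; length-deduplicate)
open import Data.List.Membership.Propositional using (_∈_)
open import Data.List.Membership.Propositional.Properties
  using (∈-filter⁺; ∈-filter⁻; ∈-allFin; ∈-lookup; ∈-map⁺; ∈-concat⁺′; ∈-deduplicate⁺)
import Data.List.Membership.Setoid.Properties as SetoidMembership
open import Data.List.Relation.Unary.Any using (here; there; index)
import Data.List.Relation.Unary.Unique.Propositional.Properties as Unique
open import Data.List.Relation.Unary.Unique.DecPropositional.Properties using (deduplicate-!)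
open import Data.Nat using (ℕ; zero; suc; _+_; _*_; _∸_; _^_; _≤_; _<_; z≤n; s≤s; _≤?_; _<?_; ⌊_/2⌋; ⌈_/2⌉)
open import Data.Nat.Induction using (<-rec)
open import Data.Nat.ListAction using (sum)
open import Data.Nat.Logarithm using (⌈log₂_⌉; ⌈log₂⌉-mono-≤)
open import Data.Nat.Logarithm.Core using (⌈log2⌉)
open import Data.Nat.Properties hiding (_≟_)
open import Algebra.Properties.CommutativeSemigroup +-commutativeSemigroup
  using () renaming (interchange to +-interchange)
open import Data.Nat.Tactic.RingSolver using (solve-∀)
open import Data.Product using (Σ; ∃; _×_; _,_; proj₁; proj₂)
open import Data.Sum using (_⊎_; inj₁; inj₂)
import Data.Sum as Sum
open import Induction.WellFounded using (Acc; acc)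
open import Relation.Binary using (tri<; tri≈; tri>)
open import Relation.Binary.PropositionalEquality
open import Relation.Nullary using (¬_; Dec; yes; no; does; contradiction)
open import Relation.Nullary.Decidable using (_×-dec_; _⊎-dec_; ¬?; dec-true; dec-false; decidable-stable; ¬¬-excluded-middle)
open import Relation.Unary using (Pred; Decidable)

odd : ℕ → Bool
odd zero          = false
odd (suc zero)    = true
odd (suc (suc m)) = odd m

bit : ℕ → ℕ → Bool
bit zero    m = odd m
bit (suc j) m = bit j ⌊ m /2⌋

digit : Bool → ℕ
digit false = 0
digit true  = 1

binary-split : ∀ m → m ≡ digit (odd m) + 2 * ⌊ m /2⌋
binary-split zero          = refl
binary-split (suc zero)    = refl
binary-split (suc (suc m)) =
  trans (cong (λ x → suc (suc x)) (binary-split m)) (shift (digit (odd m)) ⌊ m /2⌋)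
  where
  shift : ∀ b h → suc (suc (b + 2 * h)) ≡ b + 2 * suc h
  shift = solve-∀

⌊/2⌋-< : ∀ {m x} → m < 2 * x → ⌊ m /2⌋ < x
⌊/2⌋-< {m} {x} m<2x = *-cancelˡ-< 2 ⌊ m /2⌋ x (begin-strict
  2 * ⌊ m /2⌋                   ≤⟨ m≤n+m (2 * ⌊ m /2⌋) (digit (odd m)) ⟩
  digit (odd m) + 2 * ⌊ m /2⌋   ≡⟨ binary-split m ⟨
  m                             <⟨ m<2x ⟩
  2 * x                         ∎)
  where open ≤-Reasoning

bits-separate : ∀ a {m m′} → m < 2 ^ a → m′ < 2 ^ a → m ≢ m′
              → ∃ λ j → j < a × bit j m ≢ bit j m′
bits-separate zero {m} {m′} (s≤s z≤n) (s≤s z≤n) m≢m′ = contradiction refl m≢m′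
bits-separate (suc a) {m} {m′} m< m′< m≢m′ with odd m Bool.≟ odd m′
... | no last-differs = 0 , s≤s z≤n , last-differs
... | yes last-agrees =
  let j , j<a , differs = bits-separate a (⌊/2⌋-< m<) (⌊/2⌋-< m′<) halves-differ
  in  suc j , s≤s j<a , differs
  where
  halves-differ : ⌊ m /2⌋ ≢ ⌊ m′ /2⌋
  halves-differ eq = m≢m′ (begin
    m                             ≡⟨ binary-split m ⟩
    digit (odd m) + 2 * ⌊ m /2⌋    ≡⟨ cong₂ (λ b h → digit b + 2 * h) last-agrees eq ⟩
    digit (odd m′) + 2 * ⌊ m′ /2⌋  ≡⟨ binary-split m′ ⟨
    m′                            ∎)
    where open ≡-Reasoning

differ-flip : ∀ {b b′ x : Bool} → b ≢ b′ → b ≡ x → b′ ≡ not x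
differ-flip b≢b′ refl = Bool.¬-not (λ b′≡b → b≢b′ (sym b′≡b))

zero-bit : ∀ a {m} → suc m < 2 ^ a → ∃ λ j → j < a × bit j m ≡ false
zero-bit zero (s≤s ())
zero-bit (suc a) {m} m+1< with odd m in last
... | false = 0 , s≤s z≤n , last
... | true  =
  let j , j<a , zero-digit = zero-bit a (*-cancelˡ-< 2 (suc ⌊ m /2⌋) (2 ^ a) double<)
  in  suc j , s≤s j<a , zero-digit
  where
  double< : 2 * suc ⌊ m /2⌋ < 2 * 2 ^ a
  double< = subst (_< 2 * 2 ^ a) (begin
    suc m                                ≡⟨ cong suc (binary-split m) ⟩
    suc (digit (odd m) + 2 * ⌊ m /2⌋)    ≡⟨ cong (λ b → suc (digit b + 2 * ⌊ m /2⌋)) last ⟩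
    suc (suc (2 * ⌊ m /2⌋))              ≡⟨ *-suc 2 ⌊ m /2⌋ ⟨
    2 * suc ⌊ m /2⌋                      ∎) m+1<
    where open ≡-Reasoning

≤2^⌈log2⌉ : ∀ s (r : Acc _<_ s) → s ≤ 2 ^ ⌈log2⌉ s r
≤2^⌈log2⌉ zero             _        = z≤n
≤2^⌈log2⌉ (suc zero)       _        = s≤s z≤n
≤2^⌈log2⌉ (suc (suc m)) (acc rs) = begin
  2 + m                       ≤⟨ +-monoʳ-≤ 2 (m≤2⌈m/2⌉ m) ⟩
  2 + (⌈ m /2⌉ + ⌈ m /2⌉)      ≡⟨ regroup ⌈ m /2⌉ ⟩
  h + h                       ≤⟨ +-mono-≤ ih ih ⟩
  2 ^ L + 2 ^ L               ≡⟨ cong (2 ^ L +_) (+-identityʳ (2 ^ L)) ⟨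
  2 ^ suc L                   ∎
  where
  open ≤-Reasoning
  -- ⌈log₂ (m + 2)⌉ = 1 + ⌈log₂ h⌉ for h = 1 + ⌈m/2⌉, and m + 2 ≤ 2h
  h : ℕ
  h = suc ⌈ m /2⌉
  L : ℕ
  L = ⌈log2⌉ h (rs (⌈n/2⌉<n m))
  ih : h ≤ 2 ^ L
  ih = ≤2^⌈log2⌉ h (rs (⌈n/2⌉<n m))
  m≤2⌈m/2⌉ : ∀ m → m ≤ ⌈ m /2⌉ + ⌈ m /2⌉
  m≤2⌈m/2⌉ m = subst (_≤ ⌈ m /2⌉ + ⌈ m /2⌉) (⌊n/2⌋+⌈n/2⌉≡n m) (+-monoˡ-≤ ⌈ m /2⌉ (⌊n/2⌋≤⌈n/2⌉ m))
  regroup : ∀ x → 2 + (x + x) ≡ suc x + suc x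
  regroup = solve-∀

s≤2^⌈log₂s⌉ : ∀ s → s ≤ 2 ^ ⌈log₂ s ⌉
s≤2^⌈log₂s⌉ s = ≤2^⌈log2⌉ s _

⌈log2⌉≤pred : ∀ s (r : Acc _<_ s) → ⌈log2⌉ s r ≤ s ∸ 1
⌈log2⌉≤pred zero          _        = z≤n
⌈log2⌉≤pred (suc zero)    _        = z≤n
⌈log2⌉≤pred (suc (suc m)) (acc rs) =
  s≤s (≤-trans (⌈log2⌉≤pred (suc ⌈ m /2⌉) (rs (⌈n/2⌉<n m))) (⌈n/2⌉≤n m))

⌈log₂s⌉<s : ∀ {s} → 1 ≤ s → ⌈log₂ s ⌉ < s
⌈log₂s⌉<s {suc s} _ = s≤s (⌈log2⌉≤pred (suc s) _)

-- With ⌈log₂ s⌉ landmark bits, the s vertices of a class of size s ≥ 2 can be coded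
-- leaving one code unused (needed so that every coded vertex has a zero bit).
s<⌈log₂s⌉+2^⌈log₂s⌉ : ∀ {s} → 2 ≤ s → s < ⌈log₂ s ⌉ + 2 ^ ⌈log₂ s ⌉
s<⌈log₂s⌉+2^⌈log₂s⌉ {s} 2≤s = +-mono-≤ (⌈log₂⌉-mono-≤ 2≤s) (s≤2^⌈log₂s⌉ s)

_onlyIf_ : ∀ {p} {P : Set p} → ℕ → Dec P → ℕ
x onlyIf d = if does d then x else 0

onlyIf-yes : ∀ {P : Set} x (d : Dec P) → P → x onlyIf d ≡ x
onlyIf-yes x d p = cong (if_then x else 0) (dec-true d p)

onlyIf-no : ∀ {P : Set} x (d : Dec P) → ¬ P → x onlyIf d ≡ 0
onlyIf-no x d ¬p = cong (if_then x else 0) (dec-false d ¬p)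

module _ {A : Set} where

  sum-filter : ∀ {p} {P : Pred A p} (P? : Decidable P) (f : A → ℕ) xs
             → sum (map f (filter P? xs)) ≡ sum (map (λ x → f x onlyIf P? x) xs)
  sum-filter P? f [] = refl
  sum-filter P? f (x ∷ xs) with does (P? x)
  ... | true  = cong (f x +_) (sum-filter P? f xs)
  ... | false = sum-filter P? f xs

  sum-map-+ : ∀ (f g : A → ℕ) xs → sum (map (λ x → f x + g x) xs) ≡ sum (map f xs) + sum (map g xs)
  sum-map-+ f g [] = refl
  sum-map-+ f g (x ∷ xs) = trans (cong (f x + g x +_) (sum-map-+ f g xs))
                                 (+-interchange (f x) (g x) (sum (map f xs)) (sum (map g xs)))

  sum-map-mono : ∀ {f g : A → ℕ} xs → (∀ x → f x ≤ g x) → sum (map f xs) ≤ sum (map g xs)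
  sum-map-mono []       f≤g = z≤n
  sum-map-mono (x ∷ xs) f≤g = +-mono-≤ (f≤g x) (sum-map-mono xs f≤g)

  length-concatMap : ∀ {B : Set} (f : A → List B) xs → length (concatMap f xs) ≡ sum (map (λ x → length (f x)) xs)
  length-concatMap f [] = refl
  length-concatMap f (x ∷ xs) = trans (length-++ (f x)) (cong (length (f x) +_) (length-concatMap f xs))

  ∈-take : ∀ {x : A} {xs} n (x∈xs : x ∈ xs) → toℕ (index x∈xs) < n → x ∈ take n xs
  ∈-take (suc n) (here x≡y)  _         = here x≡y
  ∈-take (suc n) (there x∈xs) (s≤s lt) = there (∈-take n x∈xs lt)

count-below : ∀ k m → sum (map (λ i → 1 onlyIf (toℕ i <? m)) (allFin k)) ≤ m
count-below k m = subst (_≤ m) (cong sum (sym (map-tabulate {n = k} (λ i → i) (λ i → 1 onlyIf (toℕ i <? m)))))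
                               (count-tabulated k m)
  where
  -- shifting both i and m down by one leaves the test toℕ i <? m unchanged (definitionally)
  count-tabulated : ∀ k m → sum (tabulate {n = k} (λ i → 1 onlyIf (toℕ i <? m))) ≤ m
  count-tabulated zero    m       = z≤n
  count-tabulated (suc k) zero    = count-tabulated k zero
  count-tabulated (suc k) (suc m) = s≤s (count-tabulated k m)

index-∈-lookup : ∀ {A : Set} (xs : List A) i → index (∈-lookup {xs = xs} i) ≡ i
index-∈-lookup (x ∷ xs) fzero    = refl
index-∈-lookup (x ∷ xs) (fsuc i) = cong fsuc (index-∈-lookup xs i)

module Ranking {n k : ℕ} (c : Fin n → Fin k) where

  colourClass : Fin k → List (Fin n)
  colourClass i = filter (λ v → c v ≟ i) (allFin n)

  ∈-colourClass : ∀ {v i} → c v ≡ i → v ∈ colourClass i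
  ∈-colourClass {v} cv≡i = ∈-filter⁺ (λ u → c u ≟ _) (∈-allFin v) cv≡i

  rank : Fin n → ℕ
  rank v = toℕ (index (∈-colourClass {v} refl))

  rank<classSize : ∀ v → rank v < classSize c (c v)
  rank<classSize v = toℕ<n (index (∈-colourClass {v} refl))

  -- A colour class has no repetitions, so every membership proof gives the same position.
  rank-canonical : ∀ {v i} (cv≡i : c v ≡ i) (v∈ : v ∈ colourClass i) → rank v ≡ toℕ (index v∈)
  rank-canonical {v} refl v∈ = cong (λ p → toℕ (index p)) (membership-irrelevant _ v∈)
    where
    membership-irrelevant : (p q : v ∈ colourClass (c v)) → p ≡ q
    membership-irrelevant = SetoidMembership.unique⇒irrelevant (setoid (Fin n))
      (Decidable⇒UIP.≡-irrelevant _≟_) (Unique.filter⁺ (λ u → c u ≟ c v) (Unique.allFin⁺ n))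

  rank-injective : ∀ {u v} → c u ≡ c v → rank u ≡ rank v → u ≡ v
  rank-injective {u} {v} cu≡cv ranks≡ =
    SetoidMembership.index-injective (setoid (Fin n)) u∈ (∈-colourClass refl)
      (toℕ-injective (trans (sym (rank-canonical cu≡cv u∈)) ranks≡))
    where
    u∈ : u ∈ colourClass (c v)
    u∈ = ∈-colourClass cu≡cv

  unrank : ∀ i p → p < classSize c i → ∃ λ v → c v ≡ i × rank v ≡ p
  unrank i p p< = v , cv≡i , (begin
    rank v                 ≡⟨ rank-canonical cv≡i (∈-lookup q) ⟩
    toℕ (index (∈-lookup {xs = colourClass i} q)) ≡⟨ cong toℕ (index-∈-lookup (colourClass i) q) ⟩
    toℕ q                  ≡⟨ toℕ-fromℕ< p< ⟩
    p                      ∎)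
    where
    open ≡-Reasoning
    q : Fin (classSize c i)
    q = fromℕ< p<
    v : Fin n
    v = lookup (colourClass i) q
    cv≡i : c v ≡ i
    cv≡i = proj₂ (∈-filter⁻ (λ u → c u ≟ i) {xs = allFin n} (∈-lookup q))

-- Every inhabited predicate on ℕ has a least witness, constructively up to double negation
-- (which is enough whenever the conclusion drawn from it is decidable).
¬¬-least : ∀ {P : ℕ → Set} {m} → P m → ¬ ¬ (∃ λ b → P b × (∀ {b′} → P b′ → b ≤ b′))
¬¬-least {P} {m} = <-rec Goal step m
  where
  Goal : ℕ → Set
  Goal m = P m → ¬ ¬ (∃ λ b → P b × (∀ {b′} → P b′ → b ≤ b′))
  step : ∀ m → (∀ {b} → b < m → Goal b) → Goal m
  step m smaller pm no-least = ¬¬-excluded-middle {A = ∃ λ b → b < m × P b} λ where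
    (yes (b , b<m , pb)) → smaller b<m pb no-least
    (no none)            → no-least (m , pm , λ {b′} pb′ → ≮⇒≥ (λ b′<m → none (b′ , b′<m , pb′)))

threshold≤resolving : ∀ {n} (G H : Graph n) {t} → IsThresholdStrongDim G t
  → SpanningSubgraph G H → Connected H → ∀ W → StrongResolvingSet H W → t ≤ length W
threshold≤resolving {n} G H {t} (_ , t≤dims) G⊆H connected W resolving =
  ≤-trans (decidable-stable (t ≤? length W′) t≤|W′|) (length-deduplicate _≟_ W)
  where
  W′ : List (Fin n)
  W′ = deduplicate _≟_ W
  resolving′ : StrongResolvingSet H W′
  resolving′ u v u≢v with resolving u v u≢v
  ... | w , w∈W , resolves = w , ∈-deduplicate⁺ _≟_ w∈W , resolves
  -- a least strong resolving set exists (up to double negation) and has size ≥ t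
  t≤|W′| : ¬ ¬ (t ≤ length W′)
  t≤|W′| t≰ = ¬¬-least (W′ , deduplicate-! _≟_ W , resolving′ , refl)
    λ (b , realised , least) → t≰ (≤-trans
         (t≤dims H b G⊆H connected (realised , λ V uV rV → least (V , uV , rV , refl)))
         (least (W′ , deduplicate-! _≟_ W , resolving′ , refl)))

module Walks {n : ℕ} (H : Graph n) where

  endpoint-on-walk : ∀ {u v j} (p : Walk H u v j) → OnWalk H v p
  endpoint-on-walk nil        = here
  endpoint-on-walk (cons _ p) = there (endpoint-on-walk p)

  edge-shortest : ∀ {u v} → u ≢ v → (e : Adj H u v) → Shortest H (cons e nil)
  edge-shortest u≢v e {zero}  nil = contradiction refl u≢v
  edge-shortest u≢v e {suc j} _   = s≤s z≤n

  two-step-shortest : ∀ {u w} → u ≢ w → ¬ Adj H u w → (p : Walk H u w 2) → Shortest H p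
  two-step-shortest u≢w _    p {zero}        nil            = contradiction refl u≢w
  two-step-shortest u≢w ¬adj p {suc zero}    (cons e nil)   = contradiction e ¬adj
  two-step-shortest u≢w ¬adj p {suc (suc j)} _              = s≤s (s≤s z≤n)

-- Graphs with a universal vertex z have diameter at most two; for them strong resolution
-- reduces to a separation property of the vertices outside the candidate set.
module UniversalVertex {n : ℕ} (H : Graph n) (adj? : ∀ u v → Dec (Adj H u v))
                       (z : Fin n) (universal : ∀ {x} → x ≢ z → Adj H z x) where
  open Walks H

  geodesic : ∀ u v → u ≢ v → ∃ λ j → Σ (Walk H u v j) (Shortest H)
  geodesic u v u≢v with adj? u v | u ≟ z | v ≟ z
  ... | yes e | _        | _        = 1 , cons e nil , edge-shortest u≢v e
  ... | no ¬e | yes refl | _        = contradiction (universal (λ v≡z → u≢v (sym v≡z))) ¬e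
  ... | no ¬e | no  u≢z  | yes refl = contradiction (Graph.sym H (universal u≢z)) ¬e
  ... | no ¬e | no  u≢z  | no  v≢z  = 2 , p , two-step-shortest u≢v ¬e p
    where
    p : Walk H u v 2
    p = cons (Graph.sym H (universal u≢z)) (cons (universal v≢z) nil)

  connected : Connected H
  connected u v with u ≟ v
  ... | yes refl = 0 , nil
  ... | no u≢v   = let j , p , _ = geodesic u v u≢v in j , p

  module _ (InW : Fin n → Set) where

    Separates : Fin n → Fin n → Fin n → Set
    Separates w u v = InW w × Adj H w v × ¬ Adj H w u

    Separated : Fin n → Fin n → Set
    Separated u v = (∃ λ w → Separates w u v) ⊎ (∃ λ w → Separates w v u)

    unmarked≢marked : ∀ {u w} → ¬ InW u → InW w → u ≢ w
    unmarked≢marked u∉ w∈ refl = u∉ w∈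

    strong-resolving-criterion : (∀ v → Dec (InW v)) → (W : List (Fin n)) → (∀ {v} → InW v → v ∈ W)
      → (∀ {u v} → ¬ InW u → ¬ InW v → u ≢ v → Adj H u v)
      → (∀ {u v} → ¬ InW u → ¬ InW v → u ≢ v → Separated u v)
      → StrongResolvingSet H W
    strong-resolving-criterion InW? W InW⊆W clique separated u v u≢v with InW? v | InW? u
    ... | yes v∈ | _ = let j , p , shortest = geodesic u v u≢v
                       in  v , InW⊆W v∈ , inj₁ (j , p , shortest , endpoint-on-walk p)
    ... | no v∉ | yes u∈ = let j , p , shortest = geodesic v u (λ v≡u → u≢v (sym v≡u))
                           in  u , InW⊆W u∈ , inj₂ (j , p , shortest , endpoint-on-walk p)
    ... | no v∉ | no u∉ with separated u∉ v∉ u≢v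
    ...   | inj₁ (w , w∈ , w~v , w≁u) = w , InW⊆W w∈ , inj₁ (2 , p , shortest , there here)
      where
      p : Walk H u w 2
      p = cons (clique u∉ v∉ u≢v) (cons (Graph.sym H w~v) nil)
      shortest : Shortest H p
      shortest = two-step-shortest (unmarked≢marked u∉ w∈) (λ u~w → w≁u (Graph.sym H u~w)) p
    ...   | inj₂ (w , w∈ , w~u , w≁v) = w , InW⊆W w∈ , inj₂ (2 , p , shortest , there here)
      where
      p : Walk H v w 2
      p = cons (clique v∉ u∉ (λ v≡u → u≢v (sym v≡u))) (cons (Graph.sym H w~u) nil)
      shortest : Shortest H p
      shortest = two-step-shortest (unmarked≢marked v∉ w∈) (λ v~w → w≁v (Graph.sym H v~w)) p

-- Each colour class i receives a budget of a i
-- landmarks (its vertices of rank < a i); one further vertex z of the hub class h is made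
-- adjacent to everything. Every other vertex x of class i gets the code
-- rank x − offset i < 2^(a i) − 1 (offset i skips the landmarks and, in class h, the hub),
-- and the landmark of rank j is adjacent to x exactly when bit j of that code is 1.
module Design {n k} (G : Graph n) (c : Fin n → Fin k) (proper : ProperColouring G k c)
  (a : Fin k → ℕ) (h : Fin k)
  (a≤size      : ∀ i → a i ≤ classSize c i)
  (hub-room    : a h < classSize c h)
  (hub-capacity : classSize c h < suc (a h) + 2 ^ a h)
  (capacity    : ∀ i → i ≢ h → classSize c i < a i + 2 ^ a i)
  where

  open Ranking c

  Landmark : Fin n → Set
  Landmark v = rank v < a (c v)

  landmark? : ∀ v → Dec (Landmark v)
  landmark? v = rank v <? a (c v)

  landmark-at : ∀ i j → j < a i → ∃ λ w → Landmark w × c w ≡ i × rank w ≡ j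
  landmark-at i j j<a with unrank i j (≤-trans j<a (a≤size i))
  ... | w , refl , refl = w , j<a , refl , refl

  hub : ∃ λ v → c v ≡ h × rank v ≡ a h
  hub = unrank h (a h) hub-room

  z : Fin n
  z = proj₁ hub

  landmark≢hub : ∀ {w} → Landmark w → w ≢ z
  landmark≢hub lw refl =
    <-irrefl (trans (proj₂ (proj₂ hub)) (cong a (sym (proj₁ (proj₂ hub))))) lw

  offset : Fin k → ℕ
  offset i with i ≟ h
  ... | yes _ = suc (a i)
  ... | no  _ = a i

  class-capacity : ∀ i → classSize c i < offset i + 2 ^ a i
  class-capacity i with i ≟ h
  ... | yes refl = hub-capacity
  ... | no  i≢h  = capacity i i≢h

  Coded : Fin n → Set
  Coded v = ¬ Landmark v × v ≢ z

  code : Fin n → ℕ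
  code v = rank v ∸ offset (c v)

  offset≤rank : ∀ {v} → Coded v → offset (c v) ≤ rank v
  offset≤rank {v} (v∉ , v≢z) with c v ≟ h
  ... | no  _    = ≮⇒≥ v∉
  ... | yes cv≡h = ≤∧≢⇒< (≮⇒≥ v∉) λ av≡rv → v≢z (rank-injective
          (trans cv≡h (sym (proj₁ (proj₂ hub))))
          (trans (sym av≡rv) (trans (cong a cv≡h) (sym (proj₂ (proj₂ hub))))))

  rank≡offset+code : ∀ {v} → Coded v → rank v ≡ offset (c v) + code v
  rank≡offset+code coded = sym (m+[n∸m]≡n (offset≤rank coded))

  -- Codes avoid 2^(a i) − 1, the all-ones word, so every code has a 0 bit.
  code-room : ∀ {v} → Coded v → suc (code v) < 2 ^ a (c v)
  code-room {v} coded = +-cancelˡ-< (offset (c v)) (suc (code v)) (2 ^ a (c v)) (begin-strict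
    offset (c v) + suc (code v)  ≡⟨ +-suc (offset (c v)) (code v) ⟩
    suc (offset (c v) + code v)  ≡⟨ cong suc (rank≡offset+code coded) ⟨
    suc (rank v)                 ≤⟨ rank<classSize v ⟩
    classSize c (c v)            <⟨ class-capacity (c v) ⟩
    offset (c v) + 2 ^ a (c v)   ∎)
    where open ≤-Reasoning

  code-injective : ∀ {u v} → Coded u → Coded v → c u ≡ c v → code u ≡ code v → u ≡ v
  code-injective {u} {v} u-coded v-coded cu≡cv codes≡ = rank-injective cu≡cv (begin
    rank u                  ≡⟨ rank≡offset+code u-coded ⟩
    offset (c u) + code u   ≡⟨ cong₂ _+_ (cong offset cu≡cv) codes≡ ⟩
    offset (c v) + code v   ≡⟨ rank≡offset+code v-coded ⟨
    rank v                  ∎)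
    where open ≡-Reasoning

  Silent : Fin n → Fin n → Set
  Silent w x = Landmark w × ¬ Landmark x × bit (rank w) (code x) ≡ false

  NonEdge : Fin n → Fin n → Set
  NonEdge u v = c u ≡ c v × u ≢ z × v ≢ z × ((Landmark u × Landmark v) ⊎ Silent u v ⊎ Silent v u)

  nonEdge-sym : ∀ {u v} → NonEdge u v → NonEdge v u
  nonEdge-sym (cu≡cv , u≢z , v≢z , inj₁ (lu , lv))       = sym cu≡cv , v≢z , u≢z , inj₁ (lv , lu)
  nonEdge-sym (cu≡cv , u≢z , v≢z , inj₂ (inj₁ silent))   = sym cu≡cv , v≢z , u≢z , inj₂ (inj₂ silent)
  nonEdge-sym (cu≡cv , u≢z , v≢z , inj₂ (inj₂ silent))   = sym cu≡cv , v≢z , u≢z , inj₂ (inj₁ silent)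

  nonEdge? : ∀ u v → Dec (NonEdge u v)
  nonEdge? u v = c u ≟ c v ×-dec ¬? (u ≟ z) ×-dec ¬? (v ≟ z)
    ×-dec ((landmark? u ×-dec landmark? v) ⊎-dec silent? u v ⊎-dec silent? v u)
    where
    silent? : ∀ w x → Dec (Silent w x)
    silent? w x = landmark? w ×-dec ¬? (landmark? x) ×-dec (bit (rank w) (code x) Bool.≟ false)

  H : Graph n
  H = record
    { Adj    = λ u v → u ≢ v × ¬ NonEdge u v
    ; sym    = λ (u≢v , ¬ne) → (λ v≡u → u≢v (sym v≡u)) , (λ ne → ¬ne (nonEdge-sym ne))
    ; irrefl = λ (u≢u , _) → u≢u refl
    }

  adj? : ∀ u v → Dec (Adj H u v)
  adj? u v = ¬? (u ≟ v) ×-dec ¬? (nonEdge? u v)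

  different-colours-adjacent : ∀ {u v} → c u ≢ c v → Adj H u v
  different-colours-adjacent cu≢cv = (λ u≡v → cu≢cv (cong c u≡v)) , λ ne → cu≢cv (proj₁ ne)

  G⊆H : SpanningSubgraph G H
  G⊆H u~v = different-colours-adjacent (proper u~v)

  hub-universal : ∀ {x} → x ≢ z → Adj H z x
  hub-universal x≢z = (λ z≡x → x≢z (sym z≡x)) , λ (_ , z≢z , _) → z≢z refl

  unmarked-clique : ∀ {u v} → ¬ Landmark u → ¬ Landmark v → u ≢ v → Adj H u v
  unmarked-clique u∉ v∉ u≢v = u≢v , λ where
    (_ , _ , _ , inj₁ (lu , _))          → u∉ lu
    (_ , _ , _ , inj₂ (inj₁ (lu , _)))   → u∉ lu
    (_ , _ , _ , inj₂ (inj₂ (lv , _)))   → v∉ lv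

  landmark-sees : ∀ {w x} → Landmark w → ¬ Landmark x → bit (rank w) (code x) ≡ true → Adj H w x
  landmark-sees lw x∉ bit≡true = (λ { refl → x∉ lw }) , λ where
    (_ , _ , _ , inj₁ (_ , lx))                   → x∉ lx
    (_ , _ , _ , inj₂ (inj₁ (_ , _ , bit≡false))) → Bool.not-¬ bit≡true bit≡false
    (_ , _ , _ , inj₂ (inj₂ (lx , _)))            → x∉ lx

  landmark-ignores : ∀ {w x} → Landmark w → Coded x → c w ≡ c x → bit (rank w) (code x) ≡ false
                   → ¬ Adj H w x
  landmark-ignores lw (x∉ , x≢z) cw≡cx bit≡false (_ , ¬ne) =
    ¬ne (cw≡cx , landmark≢hub lw , x≢z , inj₂ (inj₁ (lw , x∉ , bit≡false)))

  open UniversalVertex H adj? z hub-universal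

  silent-landmark : ∀ {x} → Coded x → ∃ λ w → Landmark w × c w ≡ c x × ¬ Adj H w x
  silent-landmark {x} coded with zero-bit (a (c x)) (code-room coded)
  ... | j , j<a , bit≡false with landmark-at (c x) j j<a
  ...   | w , lw , cw≡cx , refl = w , lw , cw≡cx , landmark-ignores lw coded cw≡cx bit≡false

  differing-landmark : ∀ {w u v} → Landmark w → Coded u → Coded v → c w ≡ c u → c u ≡ c v
    → bit (rank w) (code u) ≢ bit (rank w) (code v)
    → Separates Landmark w u v ⊎ Separates Landmark w v u
  differing-landmark {w} {u} {v} lw u-coded v-coded cw≡cu cu≡cv bits≢ = by-bit-of-u _ refl
    where
    by-bit-of-u : ∀ b → bit (rank w) (code u) ≡ b
      → Separates Landmark w u v ⊎ Separates Landmark w v u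
    by-bit-of-u true  bit-u = inj₂ (lw , landmark-sees lw (proj₁ u-coded) bit-u
      , landmark-ignores lw v-coded (trans cw≡cu cu≡cv) (differ-flip bits≢ bit-u))
    by-bit-of-u false bit-u = inj₁ (lw , landmark-sees lw (proj₁ v-coded) (differ-flip bits≢ bit-u)
      , landmark-ignores lw u-coded cw≡cu bit-u)

  -- Two distinct coded vertices of one class differ in some bit j of their codes; the
  -- landmark of rank j separates them.
  same-class-separated : ∀ {u v} → Coded u → Coded v → c u ≡ c v → u ≢ v
    → Separated Landmark u v
  same-class-separated {u} {v} u-coded v-coded cu≡cv u≢v
    with bits-separate (a (c u)) (<-trans (n<1+n (code u)) (code-room u-coded))
           (subst (λ i → code v < 2 ^ a i) (sym cu≡cv) (<-trans (n<1+n (code v)) (code-room v-coded)))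
           (λ codes≡ → u≢v (code-injective u-coded v-coded cu≡cv codes≡))
  ... | j , j<a , bits≢ with landmark-at (c u) j j<a
  ...   | w , lw , cw≡cu , refl =
    Sum.map (w ,_) (w ,_) (differing-landmark lw u-coded v-coded cw≡cu cu≡cv bits≢)

  -- Every pair of distinct non-landmarks is separated by a landmark: pairs involving the hub
  -- or two classes by a silent landmark, pairs inside one class by a differing bit.
  unmarked-separated : ∀ {u v} → ¬ Landmark u → ¬ Landmark v → u ≢ v
    → Separated Landmark u v
  unmarked-separated {u} {v} u∉ v∉ u≢v with u ≟ z | v ≟ z
  ... | yes refl | yes refl = contradiction refl u≢v
  ... | yes refl | no v≢z =
    let w , lw , _ , w≁v = silent-landmark (v∉ , v≢z)
    in  inj₂ (w , lw , Graph.sym H (hub-universal (landmark≢hub lw)) , w≁v)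
  ... | no u≢z | yes refl =
    let w , lw , _ , w≁u = silent-landmark (u∉ , u≢z)
    in  inj₁ (w , lw , Graph.sym H (hub-universal (landmark≢hub lw)) , w≁u)
  ... | no u≢z | no v≢z with c u ≟ c v
  ...   | yes cu≡cv = same-class-separated (u∉ , u≢z) (v∉ , v≢z) cu≡cv u≢v
  ...   | no  cu≢cv =
    let w , lw , cw≡cu , w≁u = silent-landmark (u∉ , u≢z)
    in  inj₁ (w , lw , different-colours-adjacent (λ cw≡cv → cu≢cv (trans (sym cw≡cu) cw≡cv)) , w≁u)

  block : Fin k → List (Fin n)
  block i = take (a i) (colourClass i)

  landmarks : List (Fin n)
  landmarks = concatMap block (allFin k)

  landmark∈landmarks : ∀ {v} → Landmark v → v ∈ landmarks
  landmark∈landmarks {v} lv = ∈-concat⁺′ {xss = map block (allFin k)} (∈-take (a (c v)) (∈-colourClass refl) lv)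
    (∈-map⁺ block (∈-allFin (c v)))

  |landmarks|≤budget : length landmarks ≤ sum (map a (allFin k))
  |landmarks|≤budget = begin
    length landmarks                               ≡⟨ length-concatMap block (allFin k) ⟩
    sum (map (λ i → length (block i)) (allFin k))  ≤⟨ sum-map-mono {f = λ i → length (block i)} (allFin k) block≤ ⟩
    sum (map a (allFin k))                         ∎
    where
    open ≤-Reasoning
    block≤ : ∀ i → length (block i) ≤ a i
    block≤ i = ≤-trans (≤-reflexive (length-take (a i) (colourClass i))) (m⊓n≤m (a i) _)

  -- The landmarks strongly resolve the connected supergraph H of G.
  budget-bound : ∀ t → IsThresholdStrongDim G t → t ≤ sum (map a (allFin k))
  budget-bound t τ = ≤-trans
    (threshold≤resolving G H τ G⊆H connected landmarks
      (strong-resolving-criterion Landmark landmark? landmarks landmark∈landmarks unmarked-clique unmarked-separated))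
    |landmarks|≤budget

log-budget : ∀ {s} → 2 ≤ s → ⌈log₂ s ⌉ < s × s < ⌈log₂ s ⌉ + 2 ^ ⌈log₂ s ⌉
log-budget 2≤s = ⌈log₂s⌉<s (≤-trans (s≤s z≤n) 2≤s) , s<⌈log₂s⌉+2^⌈log₂s⌉ 2≤s

bound-large-classes : ∀ {n k} (G : Graph n) (c : Fin n → Fin k) → ProperColouring G k c
  → Fin k → (∀ i → 2 ≤ classSize c i)
  → ∀ t → IsThresholdStrongDim G t → t ≤ sumFrom 0 (λ i → ⌈log₂ classSize c i ⌉)
bound-large-classes {k = k} G c proper h large t τ = begin
  t                               ≤⟨ Design.budget-bound G c proper L h
                                       (λ i → <⇒≤ (proj₁ (log-budget (large i))))
                                       (proj₁ (log-budget (large h)))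
                                       (m<n⇒m<1+n (proj₂ (log-budget (large h))))
                                       (λ i _ → proj₂ (log-budget (large i))) t τ ⟩
  sum (map L (allFin k))          ≡⟨ sum-filter (λ i → 0 ≤? toℕ i) L (allFin k) ⟨
  sumFrom 0 L                     ∎
  where
  open ≤-Reasoning
  L : Fin k → ℕ
  L i = ⌈log₂ classSize c i ⌉

-- The singletons below
-- m are landmarks, the singleton of colour m is the hub, and each larger class i > m gets
-- ⌈log₂ |V_i|⌉ landmarks.
module SingletonBudget {n k} (c : Fin n → Fin k) (m : ℕ) (m<k : m < k)
  (singleton : ∀ i → toℕ i < suc m → classSize c i ≡ 1)
  (large     : ∀ i → suc m ≤ toℕ i → 1 < classSize c i)
  where

  L : Fin k → ℕ
  L i = ⌈log₂ classSize c i ⌉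

  -- budget i = [i < m] + [i > m]·⌈log₂ |V_i|⌉, written as two masks so that its total splits
  below above budget : Fin k → ℕ
  below  i = 1 onlyIf (toℕ i <? m)
  above  i = L i onlyIf (suc m ≤? toℕ i)
  budget i = below i + above i

  hub : Fin k
  hub = fromℕ< m<k

  data Position (i : Fin k) : Set where
    before : toℕ i < m → Position i
    at-hub : i ≡ hub → Position i
    after  : suc m ≤ toℕ i → Position i

  position : ∀ i → Position i
  position i with <-cmp (toℕ i) m
  ... | tri< i<m _ _ = before i<m
  ... | tri≈ _ i≡m _ = at-hub (toℕ-injective (trans i≡m (sym (toℕ-fromℕ< m<k))))
  ... | tri> _ _ m<i = after m<i

  budget-before : ∀ {i} → toℕ i < m → budget i ≡ 1
  budget-before {i} i<m = cong₂ _+_ (onlyIf-yes 1 (toℕ i <? m) i<m)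
                                    (onlyIf-no (L i) (suc m ≤? toℕ i) (<-asym i<m))

  budget-hub : budget hub ≡ 0
  budget-hub = cong₂ _+_ (onlyIf-no 1 (toℕ hub <? m) (λ h<m → <-irrefl (toℕ-fromℕ< m<k) h<m))
                         (onlyIf-no (L hub) (suc m ≤? toℕ hub) (λ m<h → <-irrefl (sym (toℕ-fromℕ< m<k)) m<h))

  budget-after : ∀ {i} → suc m ≤ toℕ i → budget i ≡ L i
  budget-after {i} m<i = cong₂ _+_ (onlyIf-no 1 (toℕ i <? m) (<-asym m<i))
                                   (onlyIf-yes (L i) (suc m ≤? toℕ i) m<i)

  hub-singleton : classSize c hub ≡ 1
  hub-singleton = singleton hub (≤-reflexive (cong suc (toℕ-fromℕ< m<k)))

  fits : ∀ i → budget i ≤ classSize c i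
  fits i with position i
  ... | before i<m  rewrite budget-before i<m | singleton i (m<n⇒m<1+n i<m) = ≤-refl
  ... | at-hub refl rewrite budget-hub = z≤n
  ... | after m<i   rewrite budget-after m<i = <⇒≤ (proj₁ (log-budget (large i m<i)))

  hub-room : budget hub < classSize c hub
  hub-room rewrite budget-hub | hub-singleton = s≤s z≤n

  hub-capacity : classSize c hub < suc (budget hub) + 2 ^ budget hub
  hub-capacity rewrite budget-hub | hub-singleton = s≤s (s≤s z≤n)

  capacity : ∀ i → i ≢ hub → classSize c i < budget i + 2 ^ budget i
  capacity i i≢hub with position i
  ... | before i<m  rewrite budget-before i<m | singleton i (m<n⇒m<1+n i<m) = s≤s (s≤s z≤n)
  ... | at-hub i≡h  = contradiction i≡h i≢hub
  ... | after m<i   rewrite budget-after m<i = proj₂ (log-budget (large i m<i))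

  total : sum (map budget (allFin k)) ≤ m + sumFrom (suc m) L
  total = begin
    sum (map budget (allFin k))                            ≡⟨ sum-map-+ below above (allFin k) ⟩
    sum (map below (allFin k)) + sum (map above (allFin k)) ≤⟨ +-monoˡ-≤ _ (count-below k m) ⟩
    m + sum (map above (allFin k))                         ≡⟨ cong (m +_) (sum-filter (λ i → suc m ≤? toℕ i) L (allFin k)) ⟨
    m + sumFrom (suc m) L                                  ∎
    where open ≤-Reasoning

bound-with-singletons : ∀ {n k} (G : Graph n) (c : Fin n → Fin k) → ProperColouring G k c
  → ∀ m → m < k
  → (∀ i → toℕ i < suc m → classSize c i ≡ 1)
  → (∀ i → suc m ≤ toℕ i → 1 < classSize c i)
  → ∀ t → IsThresholdStrongDim G t → t ≤ m + sumFrom (suc m) (λ i → ⌈log₂ classSize c i ⌉)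
bound-with-singletons G c proper m m<k singleton large t τ =
  ≤-trans (Design.budget-bound G c proper budget hub fits hub-room hub-capacity capacity t τ) total
  where open SingletonBudget c m m<k singleton large

colour-zero : ∀ {k} → Fin k → Σ (Fin k) λ i → toℕ i ≡ 0
colour-zero fzero    = fzero , refl
colour-zero (fsuc _) = fzero , refl

theorem5p1 : ∀ {n k} (G : Graph n) → NonComplete G → IsChromaticNumber G k
    → (c : Fin n → Fin k) → ProperColouring G k c
    → (∀ (i j : Fin k) → toℕ i ≤ toℕ j → classSize c i ≤ classSize c j)
    → ∀ t → IsThresholdStrongDim G t
    → (∀ (ℓ : ℕ) → 1 ≤ ℓ → ℓ ≤ k
    → (∀ (i : Fin k) → toℕ i < ℓ → classSize c i ≡ 1)
    → (∀ (i : Fin k) → ℓ ≤ toℕ i → 1 < classSize c i)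
    → t ≤ (ℓ ∸ 1) + sumFrom ℓ (λ i → ⌈log₂ classSize c i ⌉))
    × ((∀ (i : Fin k) → toℕ i ≡ 0 → 2 ≤ classSize c i)
    → t ≤ sumFrom 0 (λ i → ⌈log₂ classSize c i ⌉))
theorem5p1 {k = k} G (u , _) _ c proper sorted t τ = part1 , part2
  where
  L : Fin k → ℕ
  L i = ⌈log₂ classSize c i ⌉

  -- write ℓ = m + 1; then the hypotheses are exactly those of bound-with-singletons
  part1 : ∀ ℓ → 1 ≤ ℓ → ℓ ≤ k
    → (∀ i → toℕ i < ℓ → classSize c i ≡ 1) → (∀ i → ℓ ≤ toℕ i → 1 < classSize c i)
    → t ≤ (ℓ ∸ 1) + sumFrom ℓ L
  part1 (suc m) _ m<k singleton large = bound-with-singletons G c proper m m<k singleton large t τ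

  -- G has a vertex, so colour 0 exists; by sortedness every class is at least as large as it
  part2 : (∀ i → toℕ i ≡ 0 → 2 ≤ classSize c i) → t ≤ sumFrom 0 L
  part2 first-large = bound-large-classes G c proper h
    (λ i → ≤-trans (first-large h h≡0) (sorted h i (subst (_≤ toℕ i) (sym h≡0) z≤n))) t τ
    where
    h : Fin k
    h = proj₁ (colour-zero (c u))
    h≡0 : toℕ h ≡ 0
    h≡0 = proj₂ (colour-zero (c u))
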